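{- Let $G$ be a finite, simple, connected $2K_2$-free graph with diameter $3$. Then $c(G) \leq 2$.
   Context: $2K_2$ denotes the graph consisting of two disjoint edges (the complement of the 4-cycle). A graph $G$ is $H$-free if it contains no induced subgraph isomorphic to $H$. The diameter of $G$ is the maximum, over pairs of vertices, of the length of a shortest path between them. The game of cops and robbers on $G$: $k$ cops each choose a starting vertex, then a single robber chooses a vertex; then players alternate turns starting with the cops. On the cops' turn each cop stays put or moves to an adjacent vertex; on the robber's turn he stays put or moves to an adjacent vertex. All moves are visible to both sides. The cops win if at some point a cop occupies the robber's vertex. The cop number $c(G)$ is the minimum number $k$ of cops for which the cops have a winning strategy on $G$. -}

module Defs where

open import Data.Nat using (ℕ; zero; suc; _≤_)
open import Data.Fin using (Fin)
open import Data.Vec using (Vec)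
open import Data.Vec.Relation.Unary.Any using (Any)
open import Data.Vec.Relation.Binary.Pointwise.Inductive using (Pointwise)
open import Data.Product using (Σ; ∃; _×_; _,_)
open import Data.Sum using (_⊎_)
open import Relation.Nullary using (¬_; Dec)
open import Relation.Binary.PropositionalEquality using (_≡_)

record Graph (n : ℕ) : Set₁ where
  field
    Adj    : Fin n → Fin n → Set
    dec    : ∀ u v → Dec (Adj u v)
    sym    : ∀ {u v} → Adj u v → Adj v u
    irrefl : ∀ {u} → ¬ Adj u u

module _ {n : ℕ} (G : Graph n) where
  open Graph G

  data Walk : Fin n → Fin n → ℕ → Set where
    here : ∀ {u} → Walk u u zero
    cons : ∀ {u w v k} → Adj u w → Walk w v k → Walk u v (suc k)

  DistLe : Fin n → Fin n → ℕ → Set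
  DistLe u v k = Σ ℕ λ m → m ≤ k × Walk u v m

  Connected : Set
  Connected = ∀ u v → Σ ℕ λ k → Walk u v k

  Diameter : ℕ → Set
  Diameter d = (∀ u v → DistLe u v d)
             × (Σ (Fin n) λ u → Σ (Fin n) λ v →
                  ∀ m → Walk u v m → d ≤ m)

  Induced2K2 : Fin n → Fin n → Fin n → Fin n → Set
  Induced2K2 a b c d =
    ¬ a ≡ b × ¬ a ≡ c × ¬ a ≡ d × ¬ b ≡ c × ¬ b ≡ d × ¬ c ≡ d ×
    Adj a b × Adj c d ×
    ¬ Adj a c × ¬ Adj a d × ¬ Adj b c × ¬ Adj b d

  2K2-free : Set
  2K2-free = ∀ a b c d → ¬ Induced2K2 a b c d

  Move : Fin n → Fin n → Set
  Move u v = u ≡ v ⊎ Adj u v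

  -- CopsWinFrom cs r : it is the cops' turn, cops are at cs, robber at r,
  -- and the cops can force a capture in finitely many moves.
  data CopsWinFrom {k : ℕ} (cs : Vec (Fin n) k) (r : Fin n) : Set where
    caught : Any (λ c → c ≡ r) cs → CopsWinFrom cs r
    step   : (cs' : Vec (Fin n) k) → Pointwise Move cs cs' →
             (Any (λ c → c ≡ r) cs' ⊎
              (∀ r' → Move r r' → CopsWinFrom cs' r')) →
             CopsWinFrom cs r

  CopsWin : ℕ → Set
  CopsWin k = Σ (Vec (Fin n) k) λ cs → ∀ r → CopsWinFrom cs r

  CopNumberLe : ℕ → Set
  CopNumberLe m = Σ ℕ λ k → k ≤ m × CopsWin k

module Submission where

-- Fix u, v at distance 3 and a shortest path u – a – b – v.  The only
-- graph-theoretic tool is the "cross-edge" consequence of 2K₂-freeness: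
-- for edges pq and st with p ≁ s, p ≁ t and q ≁ s we must have q ∼ t.
-- Applied to the edges ux and bv it shows that every neighbour of u is
-- adjacent to b.  The cops start on a and b; if the robber is not already
-- within their reach, one round suffices:
--   * if the robber r has a neighbour x adjacent to u, the cops move to
--     b and x, and cross-edges show that every robber move ends next to
--     (or on) one of them;
--   * otherwise r has some neighbour y, which is adjacent to a, and the
--     cops move to y and a; every neighbour of r is then adjacent to a.

open import Defs
open import Data.Nat using (ℕ; _≤_; _<_; z≤n; s≤s)
open import Data.Nat.Properties using (≤-refl; ≤-antisym; <⇒≱)
open import Data.Fin using (Fin; _≟_)
import Data.Fin.Properties as Fin
open import Data.Vec using (Vec; []; _∷_)
open import Data.Vec.Relation.Unary.Any using (Any; here; there; any?)
open import Data.Vec.Relation.Binary.Pointwise.Inductive using (Pointwise; []; _∷_)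
open import Data.Product using (Σ; ∃; _×_; _,_)
open import Data.Sum using (_⊎_; inj₁; inj₂)
open import Data.Empty using (⊥-elim)
open import Relation.Nullary using (¬_; Dec; yes; no)
open import Relation.Nullary.Decidable using (_×-dec_; _⊎-dec_)
open import Relation.Binary.PropositionalEquality using (_≡_; refl)

module _ {n : ℕ} (G : Graph n) where
  open Graph G renaming (sym to adj-sym)

  Guarded : ∀ {k} → Vec (Fin n) k → Fin n → Set
  Guarded cs r = Any (λ c → Move G c r) cs

  guarded? : ∀ {k} (cs : Vec (Fin n) k) (r : Fin n) → Dec (Guarded cs r)
  guarded? cs r = any? (λ c → (c ≟ r) ⊎-dec dec c r) cs

  stepOnto : ∀ {k r} {cs : Vec (Fin n) k} → Guarded cs r →
             Σ (Vec (Fin n) k) λ cs' →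
               Pointwise (Move G) cs cs' × Any (λ c → c ≡ r) cs'
  stepOnto {r = r} {cs = _ ∷ cs} (here m) = r ∷ cs , m ∷ stay cs , here refl
    where
      stay : ∀ {k} (ds : Vec (Fin n) k) → Pointwise (Move G) ds ds
      stay []       = []
      stay (d ∷ ds) = inj₁ refl ∷ stay ds
  stepOnto {cs = c ∷ _} (there g) with stepOnto g
  ... | cs' , moves , onRobber = c ∷ cs' , inj₁ refl ∷ moves , there onRobber

  capture : ∀ {k r} {cs : Vec (Fin n) k} → Guarded cs r → CopsWinFrom G cs r
  capture g with stepOnto g
  ... | cs' , moves , onRobber = step cs' moves (inj₁ onRobber)

  winInOneRound : ∀ {k r} {cs cs' : Vec (Fin n) k} → Pointwise (Move G) cs cs' →
                  (∀ r' → Move G r r' → Guarded cs' r') → CopsWinFrom G cs r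
  winInOneRound {cs' = cs'} moves guard =
    step cs' moves (inj₂ λ r' m → capture (guard r' m))

  firstStep : ∀ {r u k} → Walk G r u k → ¬ r ≡ u → ∃ λ y → Adj r y
  firstStep here        r≢u = ⊥-elim (r≢u refl)
  firstStep (cons ry _) _   = _ , ry

  crossEdge : 2K2-free G → ∀ {p q s t} → Adj p q → Adj s t →
              ¬ Adj p s → ¬ Adj p t → ¬ Adj q s → Adj q t
  crossEdge free {p} {q} {s} {t} pq st p≁s p≁t q≁s with dec q t
  ... | yes qt = qt
  ... | no q≁t = ⊥-elim (free p q s t
        ( (λ { refl → irrefl pq })
        , (λ { refl → q≁s (adj-sym pq) })
        , (λ { refl → p≁s (adj-sym st) })
        , (λ { refl → p≁s pq })
        , (λ { refl → q≁s (adj-sym st) })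
        , (λ { refl → irrefl st })
        , pq , st , p≁s , p≁t , q≁s , q≁t))

  record Geodesic3 (u a b v : Fin n) : Set where
    field
      ua  : Adj u a
      ab  : Adj a b
      bv  : Adj b v
      far : ∀ m → Walk G u v m → 3 ≤ m

    noShortWalk : ∀ {m} → m < 3 → ¬ Walk G u v m
    noShortWalk m<3 w = <⇒≱ m<3 (far _ w)

    u≁v : ¬ Adj u v
    u≁v uv = noShortWalk (s≤s (s≤s z≤n)) (cons uv here)

    u∼x⇒x≁v : ∀ {x} → Adj u x → ¬ Adj x v
    u∼x⇒x≁v ux xv = noShortWalk ≤-refl (cons ux (cons xv here))

    u≁b : ¬ Adj u b
    u≁b ub = u∼x⇒x≁v ub bv

    a≁v : ¬ Adj a v
    a≁v = u∼x⇒x≁v ua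

  geodesicOfDiameter3 : Diameter G 3 →
    Σ (Fin n) λ u → Σ (Fin n) λ a → Σ (Fin n) λ b → Σ (Fin n) λ v → Geodesic3 u a b v
  geodesicOfDiameter3 (within , u , v , far) with within u v
  ... | m , m≤3 , w with ≤-antisym m≤3 (far m w)
  ... | refl with w
  ... | cons ua (cons ab (cons bv here)) = u , _ , _ , v , record
          { ua = ua ; ab = ab ; bv = bv ; far = far }

  module Strategy (connected : Connected G) (free : 2K2-free G)
                  {u a b v : Fin n} (path : Geodesic3 u a b v) where
    open Geodesic3 path

    u∼x⇒x∼b : ∀ {x} → Adj u x → Adj x b
    u∼x⇒x∼b ux = crossEdge free ux (adj-sym bv) u≁v u≁b (u∼x⇒x≁v ux)

    module _ {r : Fin n} (unguarded : ¬ Guarded (a ∷ b ∷ []) r) where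
      a≁r : ¬ Adj a r
      a≁r ar = unguarded (here (inj₂ ar))

      b≁r : ¬ Adj b r
      b≁r br = unguarded (there (here (inj₂ br)))

      u≁r : ¬ Adj u r
      u≁r ur = b≁r (adj-sym (u∼x⇒x∼b ur))

      replyViaNeighbourOfU : ∀ {x} → Adj r x → Adj x u →
                             ∀ r' → Move G r r' → Guarded (b ∷ x ∷ []) r'
      replyViaNeighbourOfU rx xu r' (inj₁ refl) = there (here (inj₂ (adj-sym rx)))
      replyViaNeighbourOfU rx xu r' (inj₂ rr') with dec u r' | dec r' v
      ... | yes ur' | _ = here (inj₂ (adj-sym (u∼x⇒x∼b ur')))
      ... | no u≁r' | yes r'v =
        there (here (inj₂ (crossEdge free (adj-sym xu) (adj-sym r'v)
                             u≁v u≁r' (u∼x⇒x≁v (adj-sym xu)))))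
      ... | no _    | no r'≁v =
        here (inj₂ (crossEdge free (adj-sym bv) rr' v≁r (λ vr' → r'≁v (adj-sym vr')) b≁r))
        where
          v≁r : ¬ Adj v r
          v≁r vr = a≁r (crossEdge free ua vr u≁v u≁r a≁v)

      -- No neighbour of the robber is adjacent to u: the robber's
      -- neighbourhood lies inside N(a), so the cops go to a neighbour y
      -- of r and to a.
      module _ (noBridge : ¬ ∃ λ x → Adj r x × Adj x u) where
        neighbourSeesA : ∀ {y} → Adj r y → Adj a y
        neighbourSeesA {y} ry = adj-sym (crossEdge free ry ua
          (λ ru → u≁r (adj-sym ru)) (λ ra → a≁r (adj-sym ra)) (λ yu → noBridge (y , ry , yu)))

        replyAwayFromU : ∀ {y} → Adj r y →
                         ∀ r' → Move G r r' → Guarded (y ∷ a ∷ []) r'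
        replyAwayFromU ry r' (inj₁ refl) = here (inj₂ (adj-sym ry))
        replyAwayFromU ry r' (inj₂ rr')  = there (here (inj₂ (neighbourSeesA rr')))

        someNeighbour : ∃ λ y → Adj r y
        someNeighbour with connected r u
        ... | _ , w = firstStep w λ { refl → a≁r (adj-sym ua) }

    win : ∀ r → CopsWinFrom G (a ∷ b ∷ []) r
    win r with guarded? (a ∷ b ∷ []) r
    ... | yes g = capture g
    ... | no unguarded with Fin.any? (λ x → dec r x ×-dec dec x u)
    ... | yes (x , rx , xu) =
      winInOneRound (inj₂ ab ∷ inj₂ (adj-sym (u∼x⇒x∼b (adj-sym xu))) ∷ [])
                    (replyViaNeighbourOfU unguarded rx xu)
    ... | no noBridge with someNeighbour unguarded noBridge
    ... | y , ry =
      winInOneRound (inj₂ (neighbourSeesA unguarded noBridge ry) ∷ inj₂ (adj-sym ab) ∷ [])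
                    (replyAwayFromU unguarded noBridge ry)

theorem1 : (n : ℕ) (G : Graph n) → Connected G → 2K2-free G →
           Diameter G 3 → CopNumberLe G 2
theorem1 n G connected free diam with geodesicOfDiameter3 G diam
... | _ , a , b , _ , path = 2 , ≤-refl , (a ∷ b ∷ [] , Strategy.win G connected free path)
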